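{- Let $1\le r\le 4$ be an integer and define integers $a(n)$, $n\ge0$, by the formal power series identity \[ \sum_{n=0}^\infty a(n)q^n=\sum_{n=0}^\infty \frac{q^{5n+r}}{1-q^{10n+2r}}. \] Then \[ \sum_{n=0}^\infty a(5n)q^n=\sum_{n=0}^\infty \frac{q^{5n+r}}{1-q^{10n+2r}}. \] -}

module Defs where

open import Data.Nat using (ℕ; suc; _+_; _*_; _≡ᵇ_)
open import Data.Bool using (if_then_else_)
open import Data.List using (map; upTo)
open import Data.Nat.ListAction using (sum)

-- Coefficient of q^m in  Σ_{n≥0} q^{5n+r} / (1 - q^{10n+2r}).
-- Expanding the geometric series,
--   q^{5n+r}/(1-q^{2(5n+r)}) = Σ_{k≥0} q^{(5n+r)(2k+1)},
-- so the coefficient of q^m is the number of pairs (n,k) with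
-- (5n+r)(2k+1) = m.  For r ≥ 1 only n,k ≤ m can contribute, so the
-- double sum over n,k ∈ {0,…,m} is exactly the coefficient.
term : ℕ → ℕ → ℕ → ℕ → ℕ
term r m n k = if ((5 * n + r) * (2 * k + 1)) ≡ᵇ m then 1 else 0

a : ℕ → ℕ → ℕ
a r m = sum (map (λ n → sum (map (λ k → term r m n k) (upTo (suc m)))) (upTo (suc m)))

{-# OPTIONS --safe #-}
module Submission where

-- a r m counts the factorisations m = (5n + r)(2k + 1). The first factor is never divisible
-- by 5, so when m is replaced by 5m the prime 5 must divide 2k + 1, which forces k = 5j + 2;
-- then 2k + 1 = 5(2j + 1), and (n, 5j + 2) ↦ (n, j) matches the factorisations of 5m with
-- those of m.

open import Defs
open import Data.Nat using (ℕ; zero; suc; _+_; _*_; _∸_; _≤_; _<_; _≡ᵇ_; _≟_; s≤s; z≤n; z<s; >-nonZero)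
open import Data.Nat.Properties
open import Data.Nat.Divisibility using (_∣_; _∤_; _∣?_; divides; ∣m+n∣m⇒∣n; n∣m*n; m∣m*n; ∣⇒≤)
open import Data.Nat.Primality using (prime?; euclidsLemma)
open import Data.Nat.ListAction using (sum)
open import Data.Nat.Tactic.RingSolver using (solve-∀)
open import Data.Bool using (true; false)
open import Data.Unit using (tt)
open import Data.List using (applyUpTo)
open import Data.List.Properties using (map-upTo)
open import Data.Sum using ([_,_])
open import Relation.Nullary using (yes; no; contradiction)
open import Relation.Nullary.Decidable using (from-yes; from-no)
open import Relation.Binary.PropositionalEquality
  using (_≡_; _≢_; refl; sym; trans; subst; cong; cong₂; module ≡-Reasoning)

∑< : ℕ → (ℕ → ℕ) → ℕ
∑< N f = sum (applyUpTo f N)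

syntax ∑< N (λ k → e) = ∑[ k < N ] e

∑<-cong : ∀ N {f g : ℕ → ℕ} → (∀ k → f k ≡ g k) → ∑< N f ≡ ∑< N g
∑<-cong zero    f≗g = refl
∑<-cong (suc N) f≗g = cong₂ _+_ (f≗g 0) (∑<-cong N (λ k → f≗g (suc k)))

∑<-zero : ∀ N {f : ℕ → ℕ} → (∀ k → f k ≡ 0) → ∑< N f ≡ 0
∑<-zero zero    f≗0 = refl
∑<-zero (suc N) f≗0 = cong₂ _+_ (f≗0 0) (∑<-zero N (λ k → f≗0 (suc k)))

∑<-+ : ∀ M N (f : ℕ → ℕ) → ∑< (M + N) f ≡ ∑< M f + ∑[ k < N ] f (M + k)
∑<-+ zero    N f = refl
∑<-+ (suc M) N f = begin
  f 0 + ∑< (M + N) (λ k → f (suc k))                         ≡⟨ cong (f 0 +_) (∑<-+ M N (λ k → f (suc k))) ⟩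
  f 0 + (∑< M (λ k → f (suc k)) + ∑[ k < N ] f (suc M + k))  ≡⟨ +-assoc (f 0) _ _ ⟨
  ∑< (suc M) f + ∑[ k < N ] f (suc M + k)                    ∎
  where open ≡-Reasoning

∑<-vanishing : ∀ {M N} (f : ℕ → ℕ) → (∀ k → M ≤ k → f k ≡ 0) → M ≤ N → ∑< N f ≡ ∑< M f
∑<-vanishing {M} {N} f tail≡0 M≤N = begin
  ∑< N f                              ≡⟨ cong (λ L → ∑< L f) (m+[n∸m]≡n M≤N) ⟨
  ∑< (M + (N ∸ M)) f                  ≡⟨ ∑<-+ M (N ∸ M) f ⟩
  ∑< M f + ∑[ k < N ∸ M ] f (M + k)   ≡⟨ cong (∑< M f +_) (∑<-zero (N ∸ M) (λ k → tail≡0 (M + k) (m≤m+n M k))) ⟩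
  ∑< M f + 0                          ≡⟨ +-identityʳ _ ⟩
  ∑< M f                              ∎
  where open ≡-Reasoning

∑<-blocks : ∀ M d (f : ℕ → ℕ) → ∑< (M * d) f ≡ ∑[ j < M ] ∑[ i < d ] f (j * d + i)
∑<-blocks zero    d f = refl
∑<-blocks (suc M) d f = begin
  ∑< (d + M * d) f                                    ≡⟨ ∑<-+ d (M * d) f ⟩
  ∑< d f + ∑[ k < M * d ] f (d + k)                   ≡⟨ cong (∑< d f +_) (∑<-blocks M d (λ k → f (d + k))) ⟩
  ∑< d f + ∑[ j < M ] ∑[ i < d ] f (d + (j * d + i))  ≡⟨ cong (∑< d f +_) (∑<-cong M shift) ⟨
  ∑< d f + ∑[ j < M ] ∑[ i < d ] f (suc j * d + i)    ∎
  where
  open ≡-Reasoning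
  shift : ∀ j → ∑[ i < d ] f (suc j * d + i) ≡ ∑[ i < d ] f (d + (j * d + i))
  shift j = ∑<-cong d (λ i → cong f (+-assoc d (j * d) i))

a≡∑∑ : ∀ r m → a r m ≡ ∑[ n < suc m ] ∑[ k < suc m ] term r m n k
a≡∑∑ r m = trans (cong sum (map-upTo _ (suc m)))
                 (∑<-cong (suc m) (λ n → cong sum (map-upTo (term r m n) (suc m))))

term≡1 : ∀ r m n k → (5 * n + r) * (2 * k + 1) ≡ m → term r m n k ≡ 1
term≡1 r m n k eq with (5 * n + r) * (2 * k + 1) ≡ᵇ m | ≡⇒≡ᵇ _ m eq
... | true | _ = refl

term≡0 : ∀ r m n k → (5 * n + r) * (2 * k + 1) ≢ m → term r m n k ≡ 0
term≡0 r m n k neq with (5 * n + r) * (2 * k + 1) ≡ᵇ m | ≡ᵇ⇒≡ ((5 * n + r) * (2 * k + 1)) m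
... | false | _  = refl
... | true  | eq = contradiction (eq tt) neq

k<2k+1 : ∀ k → k < 2 * k + 1
k<2k+1 k = ≤-<-trans (m≤m+n k (k + 0)) (m<m+n (2 * k) z<s)

0<2k+1 : ∀ k → 0 < 2 * k + 1
0<2k+1 k = ≤-<-trans z≤n (k<2k+1 k)

term-beyond-n : ∀ {r m n} k → m < n → term r m n k ≡ 0
term-beyond-n {r} {m} {n} k m<n = term≡0 r m n k λ eq → n≮n m (begin-strict
  m                          <⟨ m<n ⟩
  n                          ≤⟨ m≤n*m n 5 ⟩
  5 * n                      ≤⟨ m≤m+n (5 * n) r ⟩
  5 * n + r                  ≤⟨ m≤m*n (5 * n + r) (2 * k + 1) {{>-nonZero (0<2k+1 k)}} ⟩
  (5 * n + r) * (2 * k + 1)  ≡⟨ eq ⟩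
  m                          ∎)
  where open ≤-Reasoning

term-beyond-k : ∀ {r m} n {k} → 1 ≤ r → m < k → term r m n k ≡ 0
term-beyond-k {r} {m} n {k} r≥1 m<k = term≡0 r m n k λ eq → n≮n m (begin-strict
  m                          <⟨ m<k ⟩
  k                          <⟨ k<2k+1 k ⟩
  2 * k + 1                  ≤⟨ m≤n*m (2 * k + 1) (5 * n + r) {{>-nonZero (≤-trans r≥1 (m≤n+m r (5 * n)))}} ⟩
  (5 * n + r) * (2 * k + 1)  ≡⟨ eq ⟩
  m                          ∎)
  where open ≤-Reasoning

5∤5n+r : ∀ n {r} → 1 ≤ r → r ≤ 4 → 5 ∤ 5 * n + r
5∤5n+r n {suc r} _ r<4 5∣5n+r = n≮n 4 (≤-trans (∣⇒≤ (∣m+n∣m⇒∣n 5∣5n+r (m∣m*n n))) r<4)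

5∤2[5j+i]+1 : ∀ j {i} → 5 ∤ 2 * i + 1 → 5 ∤ 2 * (j * 5 + i) + 1
5∤2[5j+i]+1 j {i} 5∤2i+1 5∣odd =
  5∤2i+1 (∣m+n∣m⇒∣n (subst (5 ∣_) (odd-split j i) 5∣odd) (n∣m*n (2 * j)))
  where
  odd-split : ∀ j i → 2 * (j * 5 + i) + 1 ≡ 2 * j * 5 + (2 * i + 1)
  odd-split = solve-∀

term[5m]-off : ∀ {r} → 1 ≤ r → r ≤ 4 → ∀ m n j {i} → 5 ∤ 2 * i + 1 → term r (5 * m) n (j * 5 + i) ≡ 0
term[5m]-off {r} r≥1 r≤4 m n j {i} 5∤2i+1 = term≡0 r (5 * m) n (j * 5 + i) λ eq →
  [ 5∤5n+r n r≥1 r≤4 , 5∤2[5j+i]+1 j {i} 5∤2i+1 ]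
    (euclidsLemma (5 * n + r) _ (from-yes (prime? 5)) (divides m (trans eq (*-comm 5 m))))

odd-scale : ∀ r n j → (5 * n + r) * (2 * (j * 5 + 2) + 1) ≡ 5 * ((5 * n + r) * (2 * j + 1))
odd-scale = solve-∀

term[5m]-on : ∀ r m n j → term r (5 * m) n (j * 5 + 2) ≡ term r m n j
term[5m]-on r m n j with (5 * n + r) * (2 * j + 1) ≟ m
... | yes eq  = trans (term≡1 r (5 * m) n (j * 5 + 2) (trans (odd-scale r n j) (cong (5 *_) eq)))
                      (sym (term≡1 r m n j eq))
... | no  neq = trans (term≡0 r (5 * m) n (j * 5 + 2)
                        (λ eq → neq (*-cancelˡ-≡ _ m 5 (trans (sym (odd-scale r n j)) eq))))
                      (sym (term≡0 r m n j neq))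

∑term[5m]-block : ∀ {r} → 1 ≤ r → r ≤ 4 → ∀ m n j → ∑[ i < 5 ] term r (5 * m) n (j * 5 + i) ≡ term r m n j
∑term[5m]-block {r} r≥1 r≤4 m n j = begin
  t 0 + (t 1 + (t 2 + (t 3 + (t 4 + 0))))   ≡⟨ cong₂ _+_ (off 0 (from-no (5 ∣? 1)))
                                               (cong₂ _+_ (off 1 (from-no (5 ∣? 3)))
                                               (cong₂ _+_ (term[5m]-on r m n j)
                                               (cong₂ _+_ (off 3 (from-no (5 ∣? 7)))
                                               (cong (_+ 0) (off 4 (from-no (5 ∣? 9))))))) ⟩
  0 + (0 + (term r m n j + (0 + (0 + 0))))  ≡⟨ +-identityʳ _ ⟩
  term r m n j                              ∎
  where
  open ≡-Reasoning
  t : ℕ → ℕ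
  t i = term r (5 * m) n (j * 5 + i)
  off : ∀ i → 5 ∤ 2 * i + 1 → t i ≡ 0
  off _ = term[5m]-off r≥1 r≤4 m n j

∑term[5m]≡∑term : ∀ {r} → 1 ≤ r → r ≤ 4 → ∀ m n →
                  ∑[ k < suc (5 * m) ] term r (5 * m) n k ≡ ∑[ j < suc m ] term r m n j
∑term[5m]≡∑term {r} r≥1 r≤4 m n = begin
  ∑[ k < suc (5 * m) ] term r (5 * m) n k                 ≡⟨ ∑<-vanishing _ (λ k → term-beyond-k n r≥1) 5m<5[m+1] ⟨
  ∑[ k < suc m * 5 ] term r (5 * m) n k                   ≡⟨ ∑<-blocks (suc m) 5 (term r (5 * m) n) ⟩
  ∑[ j < suc m ] ∑[ i < 5 ] term r (5 * m) n (j * 5 + i)  ≡⟨ ∑<-cong (suc m) (∑term[5m]-block r≥1 r≤4 m n) ⟩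
  ∑[ j < suc m ] term r m n j                             ∎
  where
  open ≡-Reasoning
  5m<5[m+1] : suc (5 * m) ≤ suc m * 5
  5m<5[m+1] = +-mono-≤ (s≤s z≤n) (≤-reflexive (*-comm 5 m))

lemma4p2 : (r : ℕ) → 1 ≤ r → r ≤ 4 → (m : ℕ) → a r (5 * m) ≡ a r m
lemma4p2 r r≥1 r≤4 m = begin
  a r (5 * m)                                                   ≡⟨ a≡∑∑ r (5 * m) ⟩
  ∑[ n < suc (5 * m) ] ∑[ k < suc (5 * m) ] term r (5 * m) n k  ≡⟨ ∑<-cong (suc (5 * m)) (∑term[5m]≡∑term r≥1 r≤4 m) ⟩
  ∑[ n < suc (5 * m) ] ∑[ k < suc m ] term r m n k              ≡⟨ ∑<-vanishing _ large-n≡0 (s≤s (m≤n*m m 5)) ⟩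
  ∑[ n < suc m ] ∑[ k < suc m ] term r m n k                    ≡⟨ a≡∑∑ r m ⟨
  a r m                                                         ∎
  where
  open ≡-Reasoning
  large-n≡0 : ∀ n → m < n → ∑[ k < suc m ] term r m n k ≡ 0
  large-n≡0 n m<n = ∑<-zero (suc m) (λ k → term-beyond-n {r} k m<n)
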